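{- There exists a planar hypohamiltonian graph on exactly $34$ vertices having exactly $26$ vertices of degree $3$.
   Context: All graphs are finite and simple. A graph $G$ is hypohamiltonian if $G$ has no Hamiltonian cycle, but for every vertex $v$ of $G$ the graph $G - v$ has a Hamiltonian cycle. -}

module Defs where

open import Data.Bool using (Bool; true; false; if_then_else_)
open import Data.Nat using (ℕ; zero; suc; _≤_; _≡ᵇ_)
open import Data.Nat.DivMod using (_mod_)
open import Data.Fin using (Fin; toℕ; punchIn)
open import Data.Fin.Permutation using (Permutation′; _⟨$⟩ʳ_)
open import Data.List using (List; length; filterᵇ; allFin)
open import Data.Product using (Σ; ∃; _×_; _,_)
open import Data.Sum using (_⊎_)
open import Data.Rational using (ℚ; _+_; _*_; _-_; 0ℚ; 1ℚ) renaming (_≤_ to _≤ℚ_)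
open import Relation.Binary.PropositionalEquality using (_≡_; _≢_)
open import Relation.Nullary using (¬_)
open import Function.Definitions using (Injective)

record Graph (n : ℕ) : Set where
  field
    adj    : Fin n → Fin n → Bool
    sym    : ∀ u v → adj u v ≡ adj v u
    irrefl : ∀ v → adj v v ≡ false
open Graph public

degree : ∀ {n} → Graph n → Fin n → ℕ
degree G v = length (filterᵇ (adj G v) (allFin _))

numVerticesOfDegree : ∀ {n} → Graph n → ℕ → ℕ
numVerticesOfDegree {n} G k =
  length (filterᵇ (λ v → degree G v ≡ᵇ k) (allFin n))

_─_ : ∀ {m} → Graph (suc m) → Fin (suc m) → Graph m
G ─ v = record
  { adj    = λ i j → adj G (punchIn v i) (punchIn v j)
  ; sym    = λ i j → sym G (punchIn v i) (punchIn v j)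
  ; irrefl = λ i → irrefl G (punchIn v i)
  }

next : ∀ {n} → Fin n → Fin n
next {suc m} i = suc (toℕ i) mod (suc m)

HamiltonianCycle : ∀ {n} → Graph n → Set
HamiltonianCycle {n} G =
  3 ≤ n × Σ (Permutation′ n) λ σ → ∀ i → adj G (σ ⟨$⟩ʳ i) (σ ⟨$⟩ʳ next i) ≡ true

Hamiltonian : ∀ {n} → Graph n → Set
Hamiltonian G = HamiltonianCycle G

Hypohamiltonian : ∀ {m} → Graph (suc m) → Set
Hypohamiltonian G = ¬ Hamiltonian G × (∀ v → Hamiltonian (G ─ v))

-- Planarity, via plane straight-line drawings with rational coordinates.
Point : Set
Point = ℚ × ℚ

OnSegment : Point → Point → Point → Set
OnSegment (px , py) (qx , qy) (rx , ry) =
  Σ ℚ λ t → 0ℚ ≤ℚ t × t ≤ℚ 1ℚ ×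
    rx ≡ px + t * (qx - px) × ry ≡ py + t * (qy - py)

SameEdge : ∀ {n} → Fin n → Fin n → Fin n → Fin n → Set
SameEdge a b c d = (a ≡ c × b ≡ d) ⊎ (a ≡ d × b ≡ c)

record PlaneDrawing {n : ℕ} (G : Graph n) : Set where
  field
    pos : Fin n → Point
    pos-injective : Injective _≡_ _≡_ pos
    vertex-off-edges : ∀ v c d → adj G c d ≡ true → v ≢ c → v ≢ d →
      ¬ OnSegment (pos c) (pos d) (pos v)
    edges-noncrossing : ∀ a b c d → adj G a b ≡ true → adj G c d ≡ true →
      ¬ SameEdge a b c d → ∀ r →
      OnSegment (pos a) (pos b) r → OnSegment (pos c) (pos d) r →
      Σ (Fin n) λ v → (v ≡ a ⊎ v ≡ b) × (v ≡ c ⊎ v ≡ d) × r ≡ pos v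

Planar : ∀ {n} → Graph n → Set
Planar G = PlaneDrawing G

module Submission where

-- Every property of the graph is certified by finite data checked by evaluation.
-- Each G ─ v is Hamiltonian by an explicit cyclic order of its vertices.
-- Planarity is witnessed by a straight-line drawing with integer coordinates in
-- which two edges with a common endpoint are not collinear and any two other
-- edges are separated by a line. For non-Hamiltonicity, a Hamiltonian cycle
-- rotated to start at vertex 0 would be found by a depth-first search over
-- paths from 0 that abandons a path as soon as some vertex off it has fewer than
-- two usable neighbours left; the search finds nothing.

open import Defs renaming (sym to adj-sym)
open import Data.Product using (Σ; _×_; _,_)
open import Relation.Binary.PropositionalEquality using (_≡_; refl)
open import Data.Fin using (Fin)
open import Data.List using (List)
open import Data.Nat using (ℕ; NonZero)

module HamiltonianCycleSearch where

  open import Data.Bool using (Bool; true; false; T; not; _∨_)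
  open import Data.Bool.ListAction using (all; any)
  open import Data.Bool.Properties using (T-∨)
  open import Data.Empty using (⊥-elim)
  open import Data.Fin using (Fin; toℕ; fromℕ<)
  open import Data.Fin.Permutation using (_⟨$⟩ʳ_; _⟨$⟩ˡ_; inverseˡ; inverseʳ)
  open import Data.Fin.Properties using (toℕ<n; toℕ-injective; toℕ-fromℕ<)
  open import Data.List using (List; []; _∷_; length; filterᵇ)
  open import Data.List.Membership.Propositional using (_∈_; _∉_)
  open import Data.List.Membership.Propositional.Properties using (∈-filter⁺; ∈-length)
  open import Data.List.Relation.Unary.All as All using (All)
  open import Data.List.Relation.Unary.All.Properties using (all⁺; all⁻)
  open import Data.List.Relation.Unary.Any as Any using (here; there)
  open import Data.List.Relation.Unary.Any.Properties using (any⁺; any⁻)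
  open import Data.Nat using (ℕ; zero; suc; _+_; _∸_; _≤_; _<_; _≡ᵇ_; _<ᵇ_; _≤ᵇ_; z≤n; s≤s; NonZero)
  import Data.Nat as ℕ
  open import Data.Nat.DivMod using (_%_; m%n<n; m%n%n≡m%n; [m+n]%n≡m%n; m<n⇒m%n≡m; %-distribˡ-+)
  open import Data.Nat.GeneralisedArithmetic using (fold)
  open import Data.Nat.Properties
    using ( ≡ᵇ⇒≡; ≡⇒≡ᵇ; ≤⇒≤ᵇ; <⇒<ᵇ; +-suc; +-comm; +-assoc; +-identityʳ; m+[n∸m]≡n; <⇒≤; ≤-refl
          ; <-trans; n<1+n; ≮⇒≥; ≤-<-connex; m≤n⇒m<n∨m≡n; <-irrefl; m≤n⇒m≤1+n; ≤-<-trans; m≤n+m)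
  open import Data.Product using (∃-syntax)
  open import Data.Sum using (inj₁; inj₂)
  open import Function using (_∘_; Equivalence)
  open import Relation.Binary.PropositionalEquality using (_≢_; sym; trans; cong; subst)
  open import Relation.Binary.PropositionalEquality.Properties using (module ≡-Reasoning)
  open import Relation.Nullary using (¬_; yes; no)
  open import Relation.Nullary.Decidable using (T?)
  open import Data.List.Membership.DecPropositional ℕ._≟_ using (_∈?_)

  -- The other disjunct is explicit since it cannot be inferred through T.
  T-∨ˡ : ∀ {a} b → T a → T (a ∨ b)
  T-∨ˡ _ = Equivalence.from T-∨ ∘ inj₁

  T-∨ʳ : ∀ a {b} → T b → T (a ∨ b)
  T-∨ʳ _ = Equivalence.from T-∨ ∘ inj₂

  T-∨-resolveˡ : ∀ {a b} → ¬ T a → T (a ∨ b) → T b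
  T-∨-resolveˡ {true}  ¬a _ = ⊥-elim (¬a _)
  T-∨-resolveˡ {false} _  t = t

  T-not : ∀ {b} → T b → ¬ T (not b)
  T-not {true} _ ()

  ¬T⇒T-not : ∀ {b} → ¬ T b → T (not b)
  ¬T⇒T-not {true}  ¬t = ¬t _
  ¬T⇒T-not {false} _  = _

  infix 4 _∈ᵇ_

  _∈ᵇ_ : ℕ → List ℕ → Bool
  x ∈ᵇ xs = any (x ≡ᵇ_) xs

  ∈ᵇ⇒∈ : ∀ {x xs} → T (x ∈ᵇ xs) → x ∈ xs
  ∈ᵇ⇒∈ {x} {xs} = Any.map (≡ᵇ⇒≡ x _) ∘ any⁻ (x ≡ᵇ_) xs

  ∈⇒∈ᵇ : ∀ {x xs} → x ∈ xs → T (x ∈ᵇ xs)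
  ∈⇒∈ᵇ {x} = any⁺ (x ≡ᵇ_) ∘ Any.map (≡⇒≡ᵇ x _)

  distinct-∈⇒1<length : ∀ {A : Set} {x y : A} {xs} → x ∈ xs → y ∈ xs → x ≢ y → 1 < length xs
  distinct-∈⇒1<length (here refl) (here refl) x≢y = ⊥-elim (x≢y refl)
  distinct-∈⇒1<length (here _)    (there y∈)  _   = s≤s (∈-length y∈)
  distinct-∈⇒1<length (there x∈)  (here _)    _   = s≤s (∈-length x∈)
  distinct-∈⇒1<length (there x∈)  (there y∈)  x≢y = <-trans (distinct-∈⇒1<length x∈ y∈ x≢y) (n<1+n _)

  [m+n%d]%d≡[m+n]%d : ∀ m n d .{{_ : NonZero d}} → (m + n % d) % d ≡ (m + n) % d
  [m+n%d]%d≡[m+n]%d m n d = begin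
    (m + n % d) % d          ≡⟨ %-distribˡ-+ m (n % d) d ⟩
    (m % d + n % d % d) % d  ≡⟨ cong (λ x → (m % d + x) % d) (m%n%n≡m%n n d) ⟩
    (m % d + n % d) % d      ≡⟨ %-distribˡ-+ m n d ⟨
    (m + n) % d              ∎
    where open ≡-Reasoning

  [n+m]%n≡m : ∀ {m n} .{{_ : NonZero n}} → m < n → (n + m) % n ≡ m
  [n+m]%n≡m {m} {n} m<n = trans (cong (_% n) (+-comm n m)) (trans ([m+n]%n≡m%n m n) (m<n⇒m%n≡m m<n))

  module CyclicSuccessor (m : ℕ) where

    private
      n = suc m

    rotate : Fin n → ℕ → Fin n
    rotate i k = fold i next k

    toℕ-rotate : ∀ i k → toℕ (rotate i k) ≡ (toℕ i + k) % n
    toℕ-rotate i zero    = sym (trans (cong (_% n) (+-identityʳ (toℕ i))) (m<n⇒m%n≡m (toℕ<n i)))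
    toℕ-rotate i (suc k) = begin
      toℕ (next (rotate i k))      ≡⟨ toℕ-fromℕ< _ ⟩
      suc (toℕ (rotate i k)) % n   ≡⟨ cong (λ x → suc x % n) (toℕ-rotate i k) ⟩
      (1 + (toℕ i + k) % n) % n    ≡⟨ [m+n%d]%d≡[m+n]%d 1 (toℕ i + k) n ⟩
      suc (toℕ i + k) % n          ≡⟨ cong (_% n) (+-suc (toℕ i) k) ⟨
      (toℕ i + suc k) % n          ∎
      where open ≡-Reasoning

    rotate-period : ∀ i → rotate i n ≡ i
    rotate-period i = toℕ-injective (begin
      toℕ (rotate i n)   ≡⟨ toℕ-rotate i n ⟩
      (toℕ i + n) % n    ≡⟨ [m+n]%n≡m%n (toℕ i) n ⟩
      toℕ i % n          ≡⟨ m<n⇒m%n≡m (toℕ<n i) ⟩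
      toℕ i              ∎)
      where open ≡-Reasoning

    private
      unrotate : ∀ i k → k < n → ((n ∸ toℕ i) + (toℕ i + k)) % n ≡ k
      unrotate i k k<n = begin
        ((n ∸ toℕ i) + (toℕ i + k)) % n  ≡⟨ cong (_% n) (+-assoc (n ∸ toℕ i) (toℕ i) k) ⟨
        ((n ∸ toℕ i) + toℕ i + k) % n    ≡⟨ cong (λ x → (x + k) % n) n∸i+i≡n ⟩
        (n + k) % n                      ≡⟨ [n+m]%n≡m k<n ⟩
        k                                ∎
        where
        open ≡-Reasoning
        n∸i+i≡n = trans (+-comm (n ∸ toℕ i) (toℕ i)) (m+[n∸m]≡n (<⇒≤ (toℕ<n i)))

    rotate-injective : ∀ i {k l} → k < n → l < n → rotate i k ≡ rotate i l → k ≡ l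
    rotate-injective i {k} {l} k<n l<n eq = begin
      k                            ≡⟨ unrotate i k k<n ⟨
      (c + (toℕ i + k)) % n        ≡⟨ [m+n%d]%d≡[m+n]%d c (toℕ i + k) n ⟨
      (c + (toℕ i + k) % n) % n    ≡⟨ cong (λ x → (c + x) % n) i+k≡i+l ⟩
      (c + (toℕ i + l) % n) % n    ≡⟨ [m+n%d]%d≡[m+n]%d c (toℕ i + l) n ⟩
      (c + (toℕ i + l)) % n        ≡⟨ unrotate i l l<n ⟩
      l                            ∎
      where
      open ≡-Reasoning
      c = n ∸ toℕ i
      i+k≡i+l = trans (sym (toℕ-rotate i k)) (trans (cong toℕ eq) (toℕ-rotate i l))

    rotate-surjective : ∀ i j → ∃[ k ] k < n × rotate i k ≡ j
    rotate-surjective i j = k , m%n<n (c + toℕ j) n , toℕ-injective (begin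
      toℕ (rotate i k)                ≡⟨ toℕ-rotate i k ⟩
      (toℕ i + (c + toℕ j) % n) % n   ≡⟨ [m+n%d]%d≡[m+n]%d (toℕ i) (c + toℕ j) n ⟩
      (toℕ i + (c + toℕ j)) % n       ≡⟨ cong (_% n) (+-assoc (toℕ i) c (toℕ j)) ⟨
      (toℕ i + c + toℕ j) % n         ≡⟨ cong (λ x → (x + toℕ j) % n) (m+[n∸m]≡n (<⇒≤ (toℕ<n i))) ⟩
      (n + toℕ j) % n                 ≡⟨ [n+m]%n≡m (toℕ<n j) ⟩
      toℕ j                           ∎)
      where
      open ≡-Reasoning
      c = n ∸ toℕ i
      k = (c + toℕ j) % n

  record ClosedHamiltonianWalk {n} (G : Graph n) (s : Fin n) : Set where
    field
      vertexAt   : ℕ → Fin n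
      starts     : vertexAt 0 ≡ s
      returns    : vertexAt n ≡ s
      steps      : ∀ k → adj G (vertexAt k) (vertexAt (suc k)) ≡ true
      injective  : ∀ {k l} → k < n → l < n → vertexAt k ≡ vertexAt l → k ≡ l
      surjective : ∀ v → ∃[ k ] k < n × vertexAt k ≡ v

  hamiltonianCycle⇒closedWalk : ∀ {m} {G : Graph (suc m)} → HamiltonianCycle G → ∀ s → ClosedHamiltonianWalk G s
  hamiltonianCycle⇒closedWalk {m} (_ , σ , σ-cycle) s = record
    { vertexAt   = λ k → σ ⟨$⟩ʳ rotate r k
    ; starts     = inverseʳ σ
    ; returns    = trans (cong (σ ⟨$⟩ʳ_) (rotate-period r)) (inverseʳ σ)
    ; steps      = λ k → σ-cycle (rotate r k)
    ; injective  = λ k<n l<n → rotate-injective r k<n l<n ∘ σ-injective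
    ; surjective = λ v → let k , k<n , eq = rotate-surjective r (σ ⟨$⟩ˡ v)
                         in k , k<n , trans (cong (σ ⟨$⟩ʳ_) eq) (inverseʳ σ)
    }
    where
    open CyclicSuccessor m
    r = σ ⟨$⟩ˡ s
    σ-injective : ∀ {i j} → σ ⟨$⟩ʳ i ≡ σ ⟨$⟩ʳ j → i ≡ j
    σ-injective eq = trans (sym (inverseˡ σ)) (trans (cong (σ ⟨$⟩ˡ_) eq) (inverseˡ σ))

  -- Vertices are labelled by ℕ, and labels n and above are ignored. A search
  -- state is a path P from s, newest vertex e first, that still has to be
  -- extended by f vertices and closed at s. Each vertex w off the path needs two
  -- cycle edges, hence two free neighbours (off the path, or one of its ends e
  -- and s). When the path moves on from e, only the neighbours of e lose a free
  -- neighbour, so only they are checked before the search continues.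
  module Search (nbrs : ℕ → List ℕ) (n s : ℕ) where

    free : List ℕ → ℕ → ℕ → Bool
    free P e x = not (x ∈ᵇ P) ∨ (x ≡ᵇ e) ∨ (x ≡ᵇ s)

    freeDegree : List ℕ → ℕ → ℕ → ℕ
    freeDegree P e w = length (filterᵇ (free P e) (nbrs w))

    viable : List ℕ → ℕ → ℕ → Bool
    viable P e w = (w ∈ᵇ P) ∨ (n ≤ᵇ w) ∨ (1 <ᵇ freeDegree P e w)

    unextendable : ℕ → ℕ → List ℕ → Bool
    unextendable zero    e P = not (s ∈ᵇ nbrs e)
    unextendable (suc f) e P = all
      (λ u → (u ∈ᵇ P) ∨ not (all (viable (u ∷ P) u) (nbrs e)) ∨ unextendable f u (u ∷ P))
      (nbrs e)

    free-off : ∀ {P e x} → x ∉ P → T (free P e x)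
    free-off {P} {e} {x} x∉ = T-∨ˡ ((x ≡ᵇ e) ∨ (x ≡ᵇ s)) (¬T⇒T-not (x∉ ∘ ∈ᵇ⇒∈))

    free-end : ∀ {P e} → T (free P e e)
    free-end {P} {e} = T-∨ʳ (not (e ∈ᵇ P)) (T-∨ˡ (e ≡ᵇ s) (≡⇒≡ᵇ e e refl))

    free-start : ∀ {P e} → T (free P e s)
    free-start {P} {e} = T-∨ʳ (not (s ∈ᵇ P)) (T-∨ʳ (s ≡ᵇ e) (≡⇒≡ᵇ s s refl))

    viable-on-path : ∀ {P e w} → w ∈ P → T (viable P e w)
    viable-on-path {P} {e} {w} = T-∨ˡ ((n ≤ᵇ w) ∨ (1 <ᵇ freeDegree P e w)) ∘ ∈⇒∈ᵇ

    viable-non-vertex : ∀ {P e w} → n ≤ w → T (viable P e w)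
    viable-non-vertex {P} {e} {w} = T-∨ʳ (w ∈ᵇ P) ∘ T-∨ˡ (1 <ᵇ freeDegree P e w) ∘ ≤⇒≤ᵇ

    viable-two-free : ∀ {P e w} → 1 < freeDegree P e w → T (viable P e w)
    viable-two-free {P} {e} {w} = T-∨ʳ (w ∈ᵇ P) ∘ T-∨ʳ (n ≤ᵇ w) ∘ <⇒<ᵇ

  module _ {m} {G : Graph (suc m)} {nbrs : ℕ → List ℕ}
           (adj⇒∈ : ∀ u v → adj G u v ≡ true → toℕ v ∈ nbrs (toℕ u))
           {s : Fin (suc m)} (W : ClosedHamiltonianWalk G s) where

    open ClosedHamiltonianWalk W
    open Search nbrs (suc m) (toℕ s)

    private
      n = suc m

      label : ℕ → ℕ
      label = toℕ ∘ vertexAt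

      prefix : ℕ → List ℕ
      prefix zero    = label 0 ∷ []
      prefix (suc k) = label (suc k) ∷ prefix k

      label-injective : ∀ {k l} → k < n → l < n → label k ≡ label l → k ≡ l
      label-injective k<n l<n = injective k<n l<n ∘ toℕ-injective

      label-surjective : ∀ {w} → w < n → ∃[ j ] j < n × label j ≡ w
      label-surjective w<n = let j , j<n , eq = surjective (fromℕ< w<n)
                             in j , j<n , trans (cong toℕ eq) (toℕ-fromℕ< w<n)

      ∈-prefix : ∀ {j} k → j ≤ k → label j ∈ prefix k
      ∈-prefix zero    z≤n = here refl
      ∈-prefix (suc k) j≤k+1 with m≤n⇒m<n∨m≡n j≤k+1
      ... | inj₁ (s≤s j≤k) = there (∈-prefix k j≤k)
      ... | inj₂ refl      = here refl

      ∈-prefix⁻ : ∀ {x} k → x ∈ prefix k → ∃[ j ] j ≤ k × x ≡ label j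
      ∈-prefix⁻ zero    (here eq)  = 0 , z≤n , eq
      ∈-prefix⁻ (suc k) (here eq)  = suc k , ≤-refl , eq
      ∈-prefix⁻ (suc k) (there x∈) = let j , j≤k , eq = ∈-prefix⁻ k x∈ in j , m≤n⇒m≤1+n j≤k , eq

      ∉-prefix : ∀ {k l} → k < l → l < n → label l ∉ prefix k
      ∉-prefix {k} k<l l<n l∈ =
        let j , j≤k , eq = ∈-prefix⁻ k l∈
            j<l = ≤-<-trans j≤k k<l
        in <-irrefl (sym (label-injective l<n (<-trans j<l l<n) eq)) j<l

      step∈ : ∀ k → label (suc k) ∈ nbrs (label k)
      step∈ k = adj⇒∈ _ _ (steps k)

      step∈⁻ : ∀ k → label k ∈ nbrs (label (suc k))
      step∈⁻ k = adj⇒∈ _ _ (trans (adj-sym G _ _) (steps k))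

      -- The two free neighbours of label (i + 1) are label i and label (i + 2).
      two-free-neighbours : ∀ k i → k < i → suc i < n →
        1 < freeDegree (prefix (suc k)) (label (suc k)) (label (suc i))
      two-free-neighbours k i k<i i+1<n = distinct-∈⇒1<length
        (∈-filter⁺ (T? ∘ free P e) (step∈⁻ i) free-before)
        (∈-filter⁺ (T? ∘ free P e) (step∈ (suc i)) free-after)
        distinct
        where
        P = prefix (suc k)
        e = label (suc k)
        i<n = <-trans (n<1+n i) i+1<n
        free-before : T (free P e (label i))
        free-before with m≤n⇒m<n∨m≡n k<i
        ... | inj₁ k+1<i = free-off {P} {e} (∉-prefix k+1<i i<n)
        ... | inj₂ refl  = free-end {P} {e}
        free-after : T (free P e (label (suc (suc i))))
        free-after with m≤n⇒m<n∨m≡n i+1<n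
        ... | inj₁ i+2<n = free-off {P} {e} (∉-prefix (s≤s (<-trans k<i (n<1+n i))) i+2<n)
        ... | inj₂ refl  = subst (T ∘ free P e) (cong toℕ (sym returns)) (free-start {P} {e})
        distinct : label i ≢ label (suc (suc i))
        distinct eq with m≤n⇒m<n∨m≡n i+1<n
        ... | inj₁ i+2<n = <-irrefl (label-injective i<n i+2<n eq) (<-trans (n<1+n i) (n<1+n (suc i)))
        ... | inj₂ refl  = <-irrefl (sym (label-injective i<n (s≤s z≤n) label-i≡label-0)) (≤-<-trans z≤n k<i)
          where label-i≡label-0 = trans eq (cong toℕ (trans returns (sym starts)))

      viable-along : ∀ k → suc k < n → ∀ w → T (viable (prefix (suc k)) (label (suc k)) w)
      viable-along k k+1<n w with w ∈? prefix (suc k) | w ℕ.<? n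
      ... | yes w∈ | _       = viable-on-path {prefix (suc k)} {label (suc k)} w∈
      ... | no _   | no w≮n  = viable-non-vertex {prefix (suc k)} {label (suc k)} (≮⇒≥ w≮n)
      ... | no w∉  | yes w<n with label-surjective w<n
      ...   | j , j<n , refl with ≤-<-connex j (suc k)
      ...     | inj₁ j≤k+1     = ⊥-elim (w∉ (∈-prefix (suc k) j≤k+1))
      ...     | inj₂ (s≤s k<i) = viable-two-free {prefix (suc k)} {label (suc k)} (two-free-neighbours k _ k<i j<n)

      unextendable-along : ∀ f k → f + k ≡ m → ¬ T (unextendable f (label k) (prefix k))
      unextendable-along zero k refl = T-not (∈⇒∈ᵇ (subst (_∈ nbrs (label k)) (cong toℕ returns) (step∈ k)))
      unextendable-along (suc f) k f+k+1≡m h =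
        unextendable-along f (suc k) (trans (+-suc f k) f+k+1≡m)
          (T-∨-resolveˡ (T-not all-viable) (T-∨-resolveˡ (∉-prefix (n<1+n k) k+1<n ∘ ∈ᵇ⇒∈) extension))
        where
        u = label (suc k)
        k+1<n : suc k < n
        k+1<n = s≤s (subst (suc k ≤_) f+k+1≡m (s≤s (m≤n+m k f)))
        extension : T ((u ∈ᵇ prefix k) ∨ not (all (viable (prefix (suc k)) u) (nbrs (label k)))
                         ∨ unextendable f u (prefix (suc k)))
        extension = All.lookup (all⁺ _ (nbrs (label k)) h) (step∈ k)
        all-viable : T (all (viable (prefix (suc k)) u) (nbrs (label k)))
        all-viable = all⁻ _ {xs = nbrs (label k)} (All.tabulate λ {w} _ → viable-along k k+1<n w)

    closedWalk⇒¬unextendable : ¬ T (unextendable m (toℕ s) (toℕ s ∷ []))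
    closedWalk⇒¬unextendable =
      unextendable-along m 0 (+-identityʳ m) ∘ subst (λ x → T (unextendable m x (x ∷ []))) (cong toℕ (sym starts))

  unextendable⇒¬hamiltonian : ∀ {m} (G : Graph (suc m)) (nbrs : ℕ → List ℕ) → (∀ u v → adj G u v ≡ true → toℕ v ∈ nbrs (toℕ u)) →
    ∀ s → T (Search.unextendable nbrs (suc m) (toℕ s) m (toℕ s) (toℕ s ∷ [])) → ¬ Hamiltonian G
  unextendable⇒¬hamiltonian G nbrs adj⇒∈ s h hc = closedWalk⇒¬unextendable adj⇒∈ (hamiltonianCycle⇒closedWalk {G = G} hc s) h

module AdjacencyLists (n : ℕ) .{{_ : NonZero n}} (nbrs : ℕ → List ℕ) where

  open HamiltonianCycleSearch using (_∈ᵇ_; ∈ᵇ⇒∈)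
  open import Data.Bool using (Bool; true; false)
  import Data.Bool.Properties as Bool
  open import Data.Bool.Properties using (T-≡)
  open import Data.Fin using (toℕ)
  open import Data.Fin.Properties using (toℕ<n; toℕ-injective; toℕ-fromℕ<; all?)
  open import Data.List using (map)
  open import Data.List.Membership.Propositional using (_∈_)
  open import Data.List.Membership.Propositional.Properties using (∈-map⁺)
  open import Data.Nat.DivMod using (_mod_; m%n<n; m<n⇒m%n≡m)
  open import Function using (_∘_; Equivalence)
  open import Relation.Binary.PropositionalEquality using (trans; subst)
  open import Relation.Nullary using (Dec)
  open import Relation.Nullary.Decidable using (True; toWitness)

  adjacentᵇ : Fin n → Fin n → Bool
  adjacentᵇ u v = toℕ v ∈ᵇ nbrs (toℕ u)

  symmetric? : Dec (∀ u v → adjacentᵇ u v ≡ adjacentᵇ v u)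
  symmetric? = all? λ u → all? λ v → adjacentᵇ u v Bool.≟ adjacentᵇ v u

  loopless? : Dec (∀ v → adjacentᵇ v v ≡ false)
  loopless? = all? λ v → adjacentᵇ v v Bool.≟ false

  toGraph : True symmetric? → True loopless? → Graph n
  toGraph symmetric loopless = record
    { adj    = adjacentᵇ
    ; sym    = toWitness symmetric
    ; irrefl = toWitness loopless
    }

  adjacent⇒∈ : ∀ u v → adjacentᵇ u v ≡ true → toℕ v ∈ nbrs (toℕ u)
  adjacent⇒∈ _ _ = ∈ᵇ⇒∈ ∘ Equivalence.from T-≡

  neighbourList : Fin n → List (Fin n)
  neighbourList u = map (_mod n) (nbrs (toℕ u))

  toℕ-mod : ∀ i → toℕ i mod n ≡ i
  toℕ-mod i = toℕ-injective (trans (toℕ-fromℕ< (m%n<n (toℕ i) n)) (m<n⇒m%n≡m (toℕ<n i)))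

  adjacent⇒∈neighbourList : ∀ u v → adjacentᵇ u v ≡ true → v ∈ neighbourList u
  adjacent⇒∈neighbourList u v uv = subst (_∈ neighbourList u) (toℕ-mod v) (∈-map⁺ (_mod n) (adjacent⇒∈ u v uv))

module HamiltonianOrders {n} (f : Fin n → Fin n) where

  open import Data.Bool using (true)
  import Data.Bool.Properties as Bool
  open import Data.Fin.Permutation using (permutation)
  open import Data.Fin.Properties using (_≟_; all?; any?)
  open import Data.Nat using (_≤_)
  open import Relation.Nullary using (Dec; yes; no)
  open import Relation.Nullary.Decidable using (_×-dec_)

  preimage : Fin n → Fin n
  preimage j with any? (λ i → f i ≟ j)
  ... | yes (i , _) = i
  ... | no _        = j

  IsHamiltonianOrder : Graph n → Set
  IsHamiltonianOrder H =
    (∀ j → f (preimage j) ≡ j) × (∀ i → preimage (f i) ≡ i) × (∀ i → adj H (f i) (f (next i)) ≡ true)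

  isHamiltonianOrder? : ∀ H → Dec (IsHamiltonianOrder H)
  isHamiltonianOrder? H = all? (λ j → f (preimage j) ≟ j) ×-dec all? (λ i → preimage (f i) ≟ i)
                          ×-dec all? (λ i → adj H (f i) (f (next i)) Bool.≟ true)

  hamiltonianOrder⇒hamiltonian : ∀ {H} → 3 ≤ n → IsHamiltonianOrder H → Hamiltonian H
  hamiltonianOrder⇒hamiltonian 3≤n (f∘preimage≗id , preimage∘f≗id , steps) =
    3≤n , permutation f preimage f∘preimage≗id preimage∘f≗id , steps

module PlaneGeometry where

  open import Algebra.Properties.Group using (∙-cancelˡ)
  open import Data.Empty using (⊥)
  open import Data.List using (List; []; _∷_)
  open import Data.List.Relation.Unary.All as All using (All)
  open import Data.List.Relation.Unary.Any using (Any; here; there)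
  open import Data.Product using (∃-syntax)
  open import Data.Rational using (ℚ; _+_; _*_; _-_; -_; 0ℚ; 1ℚ; _≤_; _<_; 1/_; ≢-nonZero; nonNegative)
  open import Data.Rational.Properties
    using ( ≤-refl; <-irrefl; ≤-<-trans; <-≤-trans; ≤-total; +-0-group
          ; +-monoʳ-≤; +-monoˡ-≤; *-monoˡ-≤-nonNeg; *-monoʳ-≤-nonNeg; neg-antimono-≤
          ; +-inverseʳ; +-identityʳ; *-zeroʳ; *-zeroˡ; *-identityʳ; *-inverseʳ; *-assoc)
  open import Data.Rational.Solver using (module +-*-Solver)
  open import Data.Sum using (_⊎_; inj₁; inj₂)
  open import Relation.Binary.PropositionalEquality using (_≢_; sym; trans; cong; cong₂; subst)
  open import Relation.Binary.PropositionalEquality.Properties using (module ≡-Reasoning)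
  open import Relation.Nullary using (¬_)
  open +-*-Solver

  infix 8 _·_

  _·_ : ℚ × ℚ → Point → ℚ
  (α , β) · (x , y) = α * x + β * y

  cross : Point → Point → Point → ℚ
  cross (px , py) (qx , qy) (sx , sy) = (qx - px) * (sy - py) - (qy - py) * (sx - px)

  p≤q⇒0≤q-p : ∀ {p q} → p ≤ q → 0ℚ ≤ q - p
  p≤q⇒0≤q-p {p} {q} p≤q = subst (_≤ q - p) (+-inverseʳ p) (+-monoˡ-≤ (- p) p≤q)

  0≤p⇒1-p≤1 : ∀ {p} → 0ℚ ≤ p → 1ℚ - p ≤ 1ℚ
  0≤p⇒1-p≤1 {p} 0≤p = subst (1ℚ - p ≤_) (+-identityʳ 1ℚ) (+-monoʳ-≤ 1ℚ (neg-antimono-≤ 0≤p))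

  a+0[b-a]≡a : ∀ a b → a + 0ℚ * (b - a) ≡ a
  a+0[b-a]≡a = solve 2 (λ a b → a :+ con 0ℚ :* (b :- a) := a) refl

  a+1[b-a]≡b : ∀ a b → a + 1ℚ * (b - a) ≡ b
  a+1[b-a]≡b = solve 2 (λ a b → a :+ con 1ℚ :* (b :- a) := b) refl

  a+t[b-a]≡b+[1-t][a-b] : ∀ a b t → a + t * (b - a) ≡ b + (1ℚ - t) * (a - b)
  a+t[b-a]≡b+[1-t][a-b] = solve 3 (λ a b t → a :+ t :* (b :- a) := b :+ (con 1ℚ :- t) :* (a :- b)) refl

  convex-between : ∀ {a b t} → a ≤ b → 0ℚ ≤ t → t ≤ 1ℚ → a ≤ a + t * (b - a) × a + t * (b - a) ≤ b
  convex-between {a} {b} {t} a≤b 0≤t t≤1 = lower , upper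
    where
    instance
      _ = nonNegative 0≤t
      _ = nonNegative (p≤q⇒0≤q-p a≤b)
    lower : a ≤ a + t * (b - a)
    lower = subst (_≤ a + t * (b - a)) (+-identityʳ a)
      (+-monoʳ-≤ a (subst (_≤ t * (b - a)) (*-zeroʳ t) (*-monoˡ-≤-nonNeg t (p≤q⇒0≤q-p a≤b))))
    upper : a + t * (b - a) ≤ b
    upper = subst (a + t * (b - a) ≤_) (a+1[b-a]≡b a b) (+-monoʳ-≤ a (*-monoʳ-≤-nonNeg (b - a) t≤1))

  convex-bounds : ∀ a b {t} → 0ℚ ≤ t → t ≤ 1ℚ →
    (a ≤ a + t * (b - a) ⊎ b ≤ a + t * (b - a)) × (a + t * (b - a) ≤ a ⊎ a + t * (b - a) ≤ b)
  convex-bounds a b {t} 0≤t t≤1 with ≤-total a b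
  ... | inj₁ a≤b = let lower , upper = convex-between a≤b 0≤t t≤1 in inj₁ lower , inj₂ upper
  ... | inj₂ b≤a = let lower , upper = convex-between b≤a (p≤q⇒0≤q-p t≤1) (0≤p⇒1-p≤1 0≤t) in
    inj₂ (subst (b ≤_) reversed lower) , inj₁ (subst (_≤ a) reversed upper)
    where
    reversed : b + (1ℚ - t) * (a - b) ≡ a + t * (b - a)
    reversed = sym (a+t[b-a]≡b+[1-t][a-b] a b t)

  onSegment-swap : ∀ p q {r} → OnSegment p q r → OnSegment q p r
  onSegment-swap (px , py) (qx , qy) (t , 0≤t , t≤1 , eqx , eqy) =
    1ℚ - t , p≤q⇒0≤q-p t≤1 , 0≤p⇒1-p≤1 0≤t ,
    trans eqx (a+t[b-a]≡b+[1-t][a-b] px qx t) , trans eqy (a+t[b-a]≡b+[1-t][a-b] py qy t)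

  ·-affine : ∀ α β px py qx qy t →
    (α , β) · (px + t * (qx - px) , py + t * (qy - py)) ≡ (α , β) · (px , py) + t * ((α , β) · (qx , qy) - (α , β) · (px , py))
  ·-affine = solve 7 (λ α β px py qx qy t →
        α :* (px :+ t :* (qx :- px)) :+ β :* (py :+ t :* (qy :- py))
      := (α :* px :+ β :* py) :+ t :* ((α :* qx :+ β :* qy) :- (α :* px :+ β :* py))) refl

  ·-onSegment : ∀ u p q r → OnSegment p q r → ∃[ t ] 0ℚ ≤ t × t ≤ 1ℚ × u · r ≡ u · p + t * (u · q - u · p)
  ·-onSegment (α , β) (px , py) (qx , qy) _ (t , 0≤t , t≤1 , refl , refl) = t , 0≤t , t≤1 , ·-affine α β px py qx qy t

  Within : ℚ × ℚ → List Point → Point → Set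
  Within u xs r = Any (λ x → u · r ≤ u · x) xs × Any (λ x → u · x ≤ u · r) xs

  onSegment⇒within : ∀ {p q r} → OnSegment p q r → ∀ u → Within u (p ∷ q ∷ []) r
  onSegment⇒within {p} {q} {r} r∈ u with ·-onSegment u p q r r∈
  ... | t , 0≤t , t≤1 , eq with convex-bounds (u · p) (u · q) 0≤t t≤1
  ...   | lower , upper = from-⊎ (subst (λ x → x ≤ u · p ⊎ x ≤ u · q) (sym eq) upper) ,
                          from-⊎ (subst (λ x → u · p ≤ x ⊎ u · q ≤ x) (sym eq) lower)
    where
    from-⊎ : ∀ {P : Point → Set} → P p ⊎ P q → Any P (p ∷ q ∷ [])
    from-⊎ (inj₁ Pp) = here Pp
    from-⊎ (inj₂ Pq) = there (here Pq)

  within-self : ∀ u v → Within u (v ∷ []) v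
  within-self u v = here ≤-refl , here ≤-refl

  ≤-<-≤-contradiction : ∀ {p q r} → p ≤ q → q < r → r ≤ p → ⊥
  ≤-<-≤-contradiction p≤q q<r r≤p = <-irrefl refl (≤-<-trans p≤q (<-≤-trans q<r r≤p))

  Below : ℚ × ℚ → List Point → List Point → Set
  Below u xs ys = All (λ x → All (λ y → u · x < u · y) ys) xs

  below⇒disjoint : ∀ {xs ys} u r → Below u xs ys → Within u xs r → ¬ Within u ys r
  below⇒disjoint _ _ below (r-below , _) (_ , r-above) =
    All.lookupWith {R = λ _ → ⊥}
      (λ x-below-ys r≤x → All.lookupWith {R = λ _ → ⊥} (λ x<y y≤r → ≤-<-≤-contradiction r≤x x<y y≤r) x-below-ys r-above)
      below r-below

  p*q≡0⇒p≡0 : ∀ p q → q ≢ 0ℚ → p * q ≡ 0ℚ → p ≡ 0ℚ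
  p*q≡0⇒p≡0 p q q≢0 pq≡0 = begin
    p                ≡⟨ *-identityʳ p ⟨
    p * 1ℚ           ≡⟨ cong (p *_) (*-inverseʳ q) ⟨
    p * (q * 1/ q)   ≡⟨ *-assoc p q (1/ q) ⟨
    (p * q) * 1/ q   ≡⟨ cong (_* 1/ q) pq≡0 ⟩
    0ℚ * 1/ q        ≡⟨ *-zeroˡ (1/ q) ⟩
    0ℚ               ∎
    where
    open ≡-Reasoning
    instance _ = ≢-nonZero q≢0

  common-endpoint : ∀ p q s {r} → cross p q s ≢ 0ℚ → OnSegment p q r → OnSegment p s r → r ≡ p
  common-endpoint (px , py) (qx , qy) (sx , sy) cross≢0 (t , _ , _ , refl , refl) (u , _ , _ , eqx , eqy) =
    cong₂ _,_ (at-start px qx) (at-start py qy)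
    where
    open ≡-Reasoning
    tx≡ux : t * (qx - px) ≡ u * (sx - px)
    tx≡ux = ∙-cancelˡ +-0-group px _ _ eqx
    ty≡uy : t * (qy - py) ≡ u * (sy - py)
    ty≡uy = ∙-cancelˡ +-0-group py _ _ eqy
    t≡0 : t ≡ 0ℚ
    t≡0 = p*q≡0⇒p≡0 t _ cross≢0 (begin
      t * ((qx - px) * (sy - py) - (qy - py) * (sx - px))
        ≡⟨ solve 7 (λ t qx px sy py qy sx → t :* ((qx :- px) :* (sy :- py) :- (qy :- py) :* (sx :- px))
                    := (t :* (qx :- px)) :* (sy :- py) :- (t :* (qy :- py)) :* (sx :- px)) refl t qx px sy py qy sx ⟩
      (t * (qx - px)) * (sy - py) - (t * (qy - py)) * (sx - px)
        ≡⟨ cong₂ (λ x y → x * (sy - py) - y * (sx - px)) tx≡ux ty≡uy ⟩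
      (u * (sx - px)) * (sy - py) - (u * (sy - py)) * (sx - px)
        ≡⟨ solve 5 (λ u sx px sy py → (u :* (sx :- px)) :* (sy :- py) :- (u :* (sy :- py)) :* (sx :- px) := con 0ℚ) refl u sx px sy py ⟩
      0ℚ ∎)
    at-start : ∀ x y → x + t * (y - x) ≡ x
    at-start x y = trans (cong (λ t → x + t * (y - x)) t≡0) (a+0[b-a]≡a x y)

-- Certificates are checked in ℤ, which evaluates far faster than ℚ, and are
-- transferred along fromℤ.
module IntegerCertificates where

  open PlaneGeometry
  import Data.Integer as ℤ
  open import Data.Integer using (ℤ; -[1+_]; +0; +[1+_]; 0ℤ)
  import Data.Integer.Properties as ℤ
  open import Data.List using (List; []; _∷_; map)
  open import Data.List.Relation.Unary.All as All using (All)
  open import Data.List.Relation.Unary.All.Properties using (map⁺)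
  open import Data.List.Relation.Unary.Any as Any using (Any; satisfied)
  open import Data.Product using (proj₁; proj₂)
  open import Data.Rational using (↥_; _/_; *<*; _+_; _*_; _-_; -_; 0ℚ; _<_)
  open import Data.Rational.Literals using (fromℤ)
  open import Data.Rational.Properties using (↥p/↧p≡p)
  open import Data.Sum using (_⊎_; inj₁; inj₂)
  open import Function using (_∘_)
  open import Relation.Binary.PropositionalEquality using (_≢_; sym; trans; cong; cong₂; subst₂)
  open import Relation.Binary.PropositionalEquality.Properties using (module ≡-Reasoning)
  open import Relation.Nullary using (¬_; Dec)
  open import Relation.Nullary.Decidable using (_⊎-dec_)

  fromℤ-+ : ∀ a b → fromℤ (a ℤ.+ b) ≡ fromℤ a + fromℤ b
  fromℤ-+ a b = trans (sym (↥p/↧p≡p (fromℤ (a ℤ.+ b))))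
    (cong₂ (λ x y → (x ℤ.+ y) / 1) (sym (ℤ.*-identityʳ a)) (sym (ℤ.*-identityʳ b)))

  fromℤ-* : ∀ a b → fromℤ (a ℤ.* b) ≡ fromℤ a * fromℤ b
  fromℤ-* a b = sym (↥p/↧p≡p (fromℤ (a ℤ.* b)))

  fromℤ-neg : ∀ a → fromℤ (ℤ.- a) ≡ - fromℤ a
  fromℤ-neg -[1+ _ ]  = refl
  fromℤ-neg +0        = refl
  fromℤ-neg +[1+ _ ]  = refl

  fromℤ-- : ∀ a b → fromℤ (a ℤ.- b) ≡ fromℤ a - fromℤ b
  fromℤ-- a b = trans (fromℤ-+ a (ℤ.- b)) (cong (fromℤ a +_) (fromℤ-neg b))

  fromℤ-mono-< : ∀ {a b} → a ℤ.< b → fromℤ a < fromℤ b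
  fromℤ-mono-< {a} {b} a<b = *<* (subst₂ ℤ._<_ (sym (ℤ.*-identityʳ a)) (sym (ℤ.*-identityʳ b)) a<b)

  embed : ℤ × ℤ → Point
  embed (x , y) = fromℤ x , fromℤ y

  infix 8 _·ᶻ_

  _·ᶻ_ : ℤ × ℤ → ℤ × ℤ → ℤ
  (α , β) ·ᶻ (x , y) = α ℤ.* x ℤ.+ β ℤ.* y

  embed-· : ∀ w p → embed w · embed p ≡ fromℤ (w ·ᶻ p)
  embed-· (α , β) (x , y) = sym (trans (fromℤ-+ (α ℤ.* x) (β ℤ.* y)) (cong₂ _+_ (fromℤ-* α x) (fromℤ-* β y)))

  crossᶻ : ℤ × ℤ → ℤ × ℤ → ℤ × ℤ → ℤ
  crossᶻ (px , py) (qx , qy) (sx , sy) = (qx ℤ.- px) ℤ.* (sy ℤ.- py) ℤ.- (qy ℤ.- py) ℤ.* (sx ℤ.- px)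

  embed-cross : ∀ p q s → cross (embed p) (embed q) (embed s) ≡ fromℤ (crossᶻ p q s)
  embed-cross (px , py) (qx , qy) (sx , sy) = sym (begin
    fromℤ ((qx ℤ.- px) ℤ.* (sy ℤ.- py) ℤ.- (qy ℤ.- py) ℤ.* (sx ℤ.- px))
      ≡⟨ fromℤ-- ((qx ℤ.- px) ℤ.* (sy ℤ.- py)) ((qy ℤ.- py) ℤ.* (sx ℤ.- px)) ⟩
    fromℤ ((qx ℤ.- px) ℤ.* (sy ℤ.- py)) - fromℤ ((qy ℤ.- py) ℤ.* (sx ℤ.- px))
      ≡⟨ cong₂ _-_ (fromℤ-* (qx ℤ.- px) (sy ℤ.- py)) (fromℤ-* (qy ℤ.- py) (sx ℤ.- px)) ⟩
    fromℤ (qx ℤ.- px) * fromℤ (sy ℤ.- py) - fromℤ (qy ℤ.- py) * fromℤ (sx ℤ.- px)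
      ≡⟨ cong₂ _-_ (cong₂ _*_ (fromℤ-- qx px) (fromℤ-- sy py)) (cong₂ _*_ (fromℤ-- qy py) (fromℤ-- sx px)) ⟩
    (fromℤ qx - fromℤ px) * (fromℤ sy - fromℤ py) - (fromℤ qy - fromℤ py) * (fromℤ sx - fromℤ px) ∎)
    where open ≡-Reasoning

  Belowᶻ : ℤ × ℤ → List (ℤ × ℤ) → List (ℤ × ℤ) → Set
  Belowᶻ w xs ys = All (λ x → All (λ y → w ·ᶻ x ℤ.< w ·ᶻ y) ys) xs

  belowᶻ? : ∀ w xs ys → Dec (Belowᶻ w xs ys)
  belowᶻ? w xs ys = All.all? (λ x → All.all? (λ y → w ·ᶻ x ℤ.<? w ·ᶻ y) ys) xs

  belowᶻ⇒below : ∀ {w xs ys} → Belowᶻ w xs ys → Below (embed w) (map embed xs) (map embed ys)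
  belowᶻ⇒below {w} = map⁺ ∘ All.map (λ {x} → map⁺ ∘ All.map (λ {y} →
    subst₂ _<_ (sym (embed-· w x)) (sym (embed-· w y)) ∘ fromℤ-mono-<))

  -- By the separating axis theorem, disjoint segments are separated along the
  -- normal of one of them, or along their common direction if they are collinear.
  segmentAxes : ℤ × ℤ → ℤ × ℤ → List (ℤ × ℤ)
  segmentAxes (px , py) (qx , qy) = (py ℤ.- qy , qx ℤ.- px) ∷ (qx ℤ.- px , qy ℤ.- py) ∷ []

  Separatedᶻ : List (ℤ × ℤ) → List (ℤ × ℤ) → List (ℤ × ℤ) → Set
  Separatedᶻ ws xs ys = Any (λ w → Belowᶻ w xs ys ⊎ Belowᶻ w ys xs) ws

  separatedᶻ? : ∀ ws xs ys → Dec (Separatedᶻ ws xs ys)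
  separatedᶻ? ws xs ys = Any.any? (λ w → belowᶻ? w xs ys ⊎-dec belowᶻ? w ys xs) ws

  separatedᶻ⇒disjoint : ∀ {ws xs ys} → Separatedᶻ ws xs ys → ∀ r →
    (∀ u → Within u (map embed xs) r) → ¬ (∀ u → Within u (map embed ys) r)
  separatedᶻ⇒disjoint sep r r∈xs r∈ys with satisfied sep
  ... | w , inj₁ xs-below = below⇒disjoint (embed w) r (belowᶻ⇒below xs-below) (r∈xs (embed w)) (r∈ys (embed w))
  ... | w , inj₂ ys-below = below⇒disjoint (embed w) r (belowᶻ⇒below ys-below) (r∈ys (embed w)) (r∈xs (embed w))

  embed-injective : ∀ {p q} → embed p ≡ embed q → p ≡ q
  embed-injective eq = cong₂ _,_ (cong (↥_ ∘ proj₁) eq) (cong (↥_ ∘ proj₂) eq)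

  embed-cross≢0 : ∀ p q s → crossᶻ p q s ≢ 0ℤ → cross (embed p) (embed q) (embed s) ≢ 0ℚ
  embed-cross≢0 p q s crossᶻ≢0 eq = crossᶻ≢0 (cong ↥_ (trans (sym (embed-cross p q s)) eq))

module StraightLineDrawings where

  open PlaneGeometry
  open IntegerCertificates
  open import Data.Bool using (Bool; true; T; not)
  open import Data.Empty using (⊥-elim)
  import Data.Integer as ℤ
  open import Data.Integer using (ℤ; 0ℤ)
  open import Data.Fin.Properties using (_≟_; all?; _<?_; <-cmp)
  open import Data.List using (List; []; _∷_; _++_; filter)
  open import Data.List.Membership.Propositional using (_∈_)
  open import Data.List.Membership.Propositional.Properties using (∈-filter⁺)
  open import Data.List.Relation.Unary.All as All using (All)
  import Data.Product as Product
  open import Data.Product.Properties using (≡-dec)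
  import Data.Sum as Sum
  open import Data.Sum using (_⊎_; inj₁; inj₂)
  open import Function using (_∘_)
  open import Relation.Binary.Definitions using (tri<; tri≈; tri>)
  open import Relation.Binary.PropositionalEquality using (_≢_; sym; trans)
  open import Relation.Nullary using (¬_; Dec; yes; no)
  open import Relation.Nullary.Decidable using (True; ⌊_⌋; toWitness; toWitnessFalse; T?; ¬?; _→-dec_)
  open import Relation.Nullary.Negation using (contradiction)

  forwardEdges : ∀ {n} → (Fin n → List (Fin n)) → Fin n → List (Fin n)
  forwardEdges nbrs a = filter (a <?_) (nbrs a)

  forwardEdges-listed : ∀ {n} (G : Graph n) (nbrs : Fin n → List (Fin n)) → (∀ a b → adj G a b ≡ true → b ∈ nbrs a) →
    ∀ a b → adj G a b ≡ true → b ∈ forwardEdges nbrs a ⊎ a ∈ forwardEdges nbrs b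
  forwardEdges-listed G nbrs adj⇒∈ a b ab with <-cmp a b
  ... | tri< a<b _ _  = inj₁ (∈-filter⁺ (a <?_) (adj⇒∈ a b ab) a<b)
  ... | tri≈ _ refl _ = contradiction (trans (sym ab) (irrefl G a)) λ ()
  ... | tri> _ _ b<a  = inj₂ (∈-filter⁺ (b <?_) (adj⇒∈ b a (trans (adj-sym G b a) ab)) b<a)

  module StraightLineDrawing {n} (G : Graph n) (coords : Fin n → ℤ × ℤ) (edges : Fin n → List (Fin n))
    (listed : ∀ a b → adj G a b ≡ true → b ∈ edges a ⊎ a ∈ edges b) where

    pos : Fin n → Point
    pos = embed ∘ coords

    nonCollinearᵇ : Fin n → Fin n → Fin n → Bool
    nonCollinearᵇ v x y = not ⌊ crossᶻ (coords v) (coords x) (coords y) ℤ.≟ 0ℤ ⌋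

    shared-endpoint : ∀ v x y {r} → T (nonCollinearᵇ v x y) →
      OnSegment (pos v) (pos x) r → OnSegment (pos v) (pos y) r → r ≡ pos v
    shared-endpoint v x y h =
      common-endpoint (pos v) (pos x) (pos y) (embed-cross≢0 (coords v) (coords x) (coords y) (toWitnessFalse h))

    edgeSeparatedᵇ : Fin n → Fin n → Fin n → Fin n → Bool
    edgeSeparatedᵇ a b c d = ⌊ separatedᶻ? (segmentAxes (coords a) (coords b) ++ segmentAxes (coords c) (coords d))
                                           (coords a ∷ coords b ∷ []) (coords c ∷ coords d ∷ []) ⌋

    commonEndpointsOnlyᵇ : Fin n → Fin n → Fin n → Fin n → Bool
    commonEndpointsOnlyᵇ a b c d with a ≟ c | a ≟ d | b ≟ c | b ≟ d
    ... | yes _ | _     | _     | yes _ = true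
    ... | yes _ | _     | _     | no _  = nonCollinearᵇ a b d
    ... | no _  | yes _ | yes _ | _     = true
    ... | no _  | yes _ | no _  | _     = nonCollinearᵇ a b c
    ... | no _  | no _  | yes _ | _     = nonCollinearᵇ b a d
    ... | no _  | no _  | no _  | yes _ = nonCollinearᵇ b a c
    ... | no _  | no _  | no _  | no _  = edgeSeparatedᵇ a b c d

    CommonEndpointsOnly : Fin n → Fin n → Fin n → Fin n → Set
    CommonEndpointsOnly a b c d = ¬ SameEdge a b c d → ∀ r →
      OnSegment (pos a) (pos b) r → OnSegment (pos c) (pos d) r →
      Σ (Fin n) λ v → (v ≡ a ⊎ v ≡ b) × (v ≡ c ⊎ v ≡ d) × r ≡ pos v

    commonEndpointsOnly-swapˡ : ∀ {a b c d} → CommonEndpointsOnly a b c d → CommonEndpointsOnly b a c d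
    commonEndpointsOnly-swapˡ {a} {b} h ¬same r r∈ba r∈cd =
      let v , v∈ab , v∈cd , r≡v = h (¬same ∘ Sum.swap ∘ Sum.map Product.swap Product.swap) r
                                    (onSegment-swap (pos b) (pos a) r∈ba) r∈cd
      in v , Sum.swap v∈ab , v∈cd , r≡v

    commonEndpointsOnly-swapʳ : ∀ {a b c d} → CommonEndpointsOnly a b c d → CommonEndpointsOnly a b d c
    commonEndpointsOnly-swapʳ {c = c} {d} h ¬same r r∈ab r∈dc =
      let v , v∈ab , v∈cd , r≡v = h (¬same ∘ Sum.swap) r r∈ab (onSegment-swap (pos d) (pos c) r∈dc)
      in v , v∈ab , Sum.swap v∈cd , r≡v

    commonEndpointsOnlyᵇ-sound : ∀ a b c d → T (commonEndpointsOnlyᵇ a b c d) → CommonEndpointsOnly a b c d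
    commonEndpointsOnlyᵇ-sound a b c d h ¬same r r∈ab r∈cd with a ≟ c | a ≟ d | b ≟ c | b ≟ d
    ... | yes refl | _        | _        | yes refl = ⊥-elim (¬same (inj₁ (refl , refl)))
    ... | yes refl | _        | _        | no _     =
      a , inj₁ refl , inj₁ refl , shared-endpoint a b d h r∈ab r∈cd
    ... | no _     | yes refl | yes refl | _        = ⊥-elim (¬same (inj₂ (refl , refl)))
    ... | no _     | yes refl | no _     | _        =
      a , inj₁ refl , inj₂ refl , shared-endpoint a b c h r∈ab (onSegment-swap (pos c) (pos a) r∈cd)
    ... | no _     | no _     | yes refl | _        =
      b , inj₂ refl , inj₁ refl , shared-endpoint b a d h (onSegment-swap (pos a) (pos b) r∈ab) r∈cd
    ... | no _     | no _     | no _     | yes refl =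
      b , inj₂ refl , inj₂ refl ,
      shared-endpoint b a c h (onSegment-swap (pos a) (pos b) r∈ab) (onSegment-swap (pos c) (pos b) r∈cd)
    ... | no _     | no _     | no _     | no _     =
      ⊥-elim (separatedᶻ⇒disjoint (toWitness h) r (onSegment⇒within r∈ab) (onSegment⇒within r∈cd))

    coords-injective? : Dec (∀ x y → coords x ≡ coords y → x ≡ y)
    coords-injective? = all? λ x → all? λ y → ≡-dec ℤ._≟_ ℤ._≟_ (coords x) (coords y) →-dec (x ≟ y)

    OffEdge : Fin n → Fin n → Fin n → Set
    OffEdge c d v = Separatedᶻ (segmentAxes (coords c) (coords d)) (coords c ∷ coords d ∷ []) (coords v ∷ [])

    offEdge-sound : ∀ c d v → OffEdge c d v → ¬ OnSegment (pos c) (pos d) (pos v)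
    offEdge-sound c d v sep v∈cd = separatedᶻ⇒disjoint sep (pos v) (onSegment⇒within v∈cd) (λ u → within-self u (pos v))

    vertices-off-edges? : Dec (∀ c → All (λ d → ∀ v → v ≢ c → v ≢ d → OffEdge c d v) (edges c))
    vertices-off-edges? = all? λ c → All.all? (λ d → all? λ v →
      ¬? (v ≟ c) →-dec ¬? (v ≟ d) →-dec separatedᶻ? _ _ _) (edges c)

    edges-meet-at-endpoints? : Dec (∀ a → All (λ b → ∀ c → All (λ d → T (commonEndpointsOnlyᵇ a b c d)) (edges c)) (edges a))
    edges-meet-at-endpoints? = all? λ a → All.all? (λ b → all? λ c → All.all? (λ d → T? (commonEndpointsOnlyᵇ a b c d)) (edges c)) (edges a)

    vertices-off-edges : True vertices-off-edges? → ∀ v c d → adj G c d ≡ true → v ≢ c → v ≢ d →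
      ¬ OnSegment (pos c) (pos d) (pos v)
    vertices-off-edges off v c d cd v≢c v≢d with listed c d cd
    ... | inj₁ d∈ = offEdge-sound c d v (All.lookup (toWitness off c) d∈ v v≢c v≢d)
    ... | inj₂ c∈ = offEdge-sound d c v (All.lookup (toWitness off d) c∈ v v≢d v≢c) ∘ onSegment-swap (pos c) (pos d)

    listed-noncrossing : True edges-meet-at-endpoints? → ∀ {a b c d} → b ∈ edges a → d ∈ edges c →
      CommonEndpointsOnly a b c d
    listed-noncrossing meet {a} {b} {c} {d} b∈ d∈ =
      commonEndpointsOnlyᵇ-sound a b c d (All.lookup (All.lookup (toWitness meet a) b∈ c) d∈)

    edges-noncrossing : True edges-meet-at-endpoints? → ∀ a b c d → adj G a b ≡ true → adj G c d ≡ true →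
      CommonEndpointsOnly a b c d
    edges-noncrossing meet a b c d ab cd with listed a b ab | listed c d cd
    ... | inj₁ b∈ | inj₁ d∈ = listed-noncrossing meet b∈ d∈
    ... | inj₂ a∈ | inj₁ d∈ = commonEndpointsOnly-swapˡ (listed-noncrossing meet a∈ d∈)
    ... | inj₁ b∈ | inj₂ c∈ = commonEndpointsOnly-swapʳ (listed-noncrossing meet b∈ c∈)
    ... | inj₂ a∈ | inj₂ c∈ = commonEndpointsOnly-swapˡ (commonEndpointsOnly-swapʳ (listed-noncrossing meet a∈ c∈))

    toPlaneDrawing : True coords-injective? → True vertices-off-edges? → True edges-meet-at-endpoints? → PlaneDrawing G
    toPlaneDrawing injective off meet = record
      { pos               = pos
      ; pos-injective     = λ {x} {y} → toWitness injective x y ∘ embed-injective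
      ; vertex-off-edges  = vertices-off-edges off
      ; edges-noncrossing = edges-noncrossing meet
      }

module Witness where

  open HamiltonianCycleSearch using (unextendable⇒¬hamiltonian)
  open StraightLineDrawings using (module StraightLineDrawing; forwardEdges; forwardEdges-listed)
  open HamiltonianOrders using (isHamiltonianOrder?; hamiltonianOrder⇒hamiltonian)
  import Data.Fin as Fin
  open import Data.Fin.Properties using (all?)
  open import Data.Integer using (ℤ; +_; -_)
  open import Data.List using (List; []; _∷_; head; drop)
  open import Data.Maybe using (fromMaybe)
  open import Data.Nat using (ℕ; s≤s; z≤n)
  open import Data.Nat.DivMod using (_mod_)
  open import Data.Vec using (Vec; []; _∷_; lookup)
  open import Relation.Nullary using (¬_)
  open import Relation.Nullary.Decidable using (toWitness)

  neighbourTable : List (List ℕ)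
  neighbourTable =
      (1 ∷ 3 ∷ 20 ∷ 23 ∷ [])
    ∷ (0 ∷ 2 ∷ 30 ∷ [])
    ∷ (1 ∷ 3 ∷ 24 ∷ 27 ∷ [])
    ∷ (0 ∷ 2 ∷ 33 ∷ [])
    ∷ (5 ∷ 8 ∷ 14 ∷ [])
    ∷ (4 ∷ 6 ∷ 16 ∷ [])
    ∷ (5 ∷ 7 ∷ 21 ∷ [])
    ∷ (6 ∷ 8 ∷ 32 ∷ [])
    ∷ (4 ∷ 7 ∷ 18 ∷ [])
    ∷ (10 ∷ 13 ∷ 17 ∷ [])
    ∷ (9 ∷ 11 ∷ 19 ∷ [])
    ∷ (10 ∷ 12 ∷ 25 ∷ [])
    ∷ (11 ∷ 13 ∷ 29 ∷ [])
    ∷ (9 ∷ 12 ∷ 15 ∷ [])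
    ∷ (4 ∷ 15 ∷ 17 ∷ [])
    ∷ (13 ∷ 14 ∷ 16 ∷ 28 ∷ [])
    ∷ (5 ∷ 15 ∷ 22 ∷ [])
    ∷ (9 ∷ 14 ∷ 18 ∷ [])
    ∷ (8 ∷ 17 ∷ 19 ∷ 31 ∷ [])
    ∷ (10 ∷ 18 ∷ 26 ∷ [])
    ∷ (0 ∷ 21 ∷ 32 ∷ 33 ∷ [])
    ∷ (6 ∷ 20 ∷ 22 ∷ [])
    ∷ (16 ∷ 21 ∷ 23 ∷ [])
    ∷ (0 ∷ 22 ∷ 28 ∷ 30 ∷ [])
    ∷ (2 ∷ 25 ∷ 29 ∷ 30 ∷ [])
    ∷ (11 ∷ 24 ∷ 26 ∷ [])
    ∷ (19 ∷ 25 ∷ 27 ∷ [])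
    ∷ (2 ∷ 26 ∷ 31 ∷ 33 ∷ [])
    ∷ (15 ∷ 23 ∷ 29 ∷ [])
    ∷ (12 ∷ 24 ∷ 28 ∷ [])
    ∷ (1 ∷ 23 ∷ 24 ∷ [])
    ∷ (18 ∷ 27 ∷ 32 ∷ [])
    ∷ (7 ∷ 20 ∷ 31 ∷ [])
    ∷ (3 ∷ 20 ∷ 27 ∷ [])
    ∷ []

  neighbours : ℕ → List ℕ
  neighbours k = fromMaybe [] (head (drop k neighbourTable))

  open AdjacencyLists 34 neighbours

  G : Graph 34
  G = toGraph _ _

  G-nonHamiltonian : ¬ Hamiltonian G
  G-nonHamiltonian = unextendable⇒¬hamiltonian G neighbours adjacent⇒∈ Fin.zero _

  cyclesOfDeletions : Vec (Vec ℕ 33) 34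
  cyclesOfDeletions =
      (0 ∷ 1 ∷ 2 ∷ 32 ∷ 19 ∷ 20 ∷ 5 ∷ 4 ∷ 3 ∷ 7 ∷ 6 ∷ 31 ∷ 30 ∷ 26 ∷ 25 ∷ 18 ∷ 17 ∷ 16 ∷ 13 ∷ 14 ∷ 15 ∷ 21 ∷ 22 ∷ 27 ∷ 28 ∷ 11 ∷ 12 ∷ 8 ∷ 9 ∷ 10 ∷ 24 ∷ 23 ∷ 29 ∷ [])
    ∷ (29 ∷ 22 ∷ 0 ∷ 2 ∷ 1 ∷ 26 ∷ 32 ∷ 19 ∷ 20 ∷ 21 ∷ 15 ∷ 4 ∷ 5 ∷ 6 ∷ 31 ∷ 30 ∷ 17 ∷ 7 ∷ 3 ∷ 13 ∷ 16 ∷ 8 ∷ 9 ∷ 18 ∷ 25 ∷ 24 ∷ 10 ∷ 11 ∷ 12 ∷ 14 ∷ 27 ∷ 28 ∷ 23 ∷ [])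
    ∷ (1 ∷ 0 ∷ 2 ∷ 32 ∷ 19 ∷ 20 ∷ 5 ∷ 4 ∷ 3 ∷ 7 ∷ 6 ∷ 31 ∷ 30 ∷ 26 ∷ 25 ∷ 18 ∷ 17 ∷ 16 ∷ 13 ∷ 14 ∷ 15 ∷ 21 ∷ 22 ∷ 27 ∷ 28 ∷ 11 ∷ 12 ∷ 8 ∷ 9 ∷ 10 ∷ 24 ∷ 23 ∷ 29 ∷ [])
    ∷ (32 ∷ 19 ∷ 0 ∷ 1 ∷ 2 ∷ 23 ∷ 29 ∷ 22 ∷ 21 ∷ 20 ∷ 5 ∷ 4 ∷ 15 ∷ 14 ∷ 27 ∷ 28 ∷ 11 ∷ 12 ∷ 8 ∷ 9 ∷ 10 ∷ 24 ∷ 25 ∷ 18 ∷ 17 ∷ 16 ∷ 13 ∷ 3 ∷ 7 ∷ 6 ∷ 31 ∷ 30 ∷ 26 ∷ [])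
    ∷ (4 ∷ 5 ∷ 6 ∷ 7 ∷ 17 ∷ 16 ∷ 13 ∷ 14 ∷ 12 ∷ 8 ∷ 9 ∷ 18 ∷ 25 ∷ 24 ∷ 10 ∷ 11 ∷ 28 ∷ 27 ∷ 22 ∷ 0 ∷ 1 ∷ 29 ∷ 23 ∷ 2 ∷ 3 ∷ 32 ∷ 26 ∷ 30 ∷ 31 ∷ 19 ∷ 20 ∷ 21 ∷ 15 ∷ [])
    ∷ (4 ∷ 7 ∷ 6 ∷ 5 ∷ 20 ∷ 19 ∷ 31 ∷ 30 ∷ 17 ∷ 18 ∷ 9 ∷ 10 ∷ 24 ∷ 25 ∷ 26 ∷ 32 ∷ 3 ∷ 0 ∷ 1 ∷ 2 ∷ 23 ∷ 29 ∷ 22 ∷ 21 ∷ 15 ∷ 14 ∷ 27 ∷ 28 ∷ 11 ∷ 12 ∷ 8 ∷ 16 ∷ 13 ∷ [])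
    ∷ (5 ∷ 4 ∷ 7 ∷ 6 ∷ 31 ∷ 30 ∷ 17 ∷ 16 ∷ 13 ∷ 14 ∷ 12 ∷ 8 ∷ 9 ∷ 18 ∷ 25 ∷ 26 ∷ 2 ∷ 1 ∷ 29 ∷ 23 ∷ 24 ∷ 10 ∷ 11 ∷ 28 ∷ 27 ∷ 22 ∷ 0 ∷ 3 ∷ 32 ∷ 19 ∷ 20 ∷ 21 ∷ 15 ∷ [])
    ∷ (6 ∷ 5 ∷ 4 ∷ 7 ∷ 17 ∷ 18 ∷ 9 ∷ 10 ∷ 24 ∷ 25 ∷ 26 ∷ 30 ∷ 31 ∷ 19 ∷ 32 ∷ 3 ∷ 0 ∷ 1 ∷ 2 ∷ 23 ∷ 29 ∷ 22 ∷ 27 ∷ 28 ∷ 11 ∷ 12 ∷ 8 ∷ 16 ∷ 13 ∷ 14 ∷ 15 ∷ 21 ∷ 20 ∷ [])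
    ∷ (4 ∷ 5 ∷ 6 ∷ 7 ∷ 31 ∷ 19 ∷ 20 ∷ 21 ∷ 15 ∷ 14 ∷ 12 ∷ 8 ∷ 9 ∷ 18 ∷ 25 ∷ 24 ∷ 10 ∷ 11 ∷ 28 ∷ 27 ∷ 22 ∷ 0 ∷ 1 ∷ 29 ∷ 23 ∷ 2 ∷ 3 ∷ 32 ∷ 26 ∷ 30 ∷ 17 ∷ 16 ∷ 13 ∷ [])
    ∷ (9 ∷ 10 ∷ 11 ∷ 12 ∷ 14 ∷ 13 ∷ 16 ∷ 17 ∷ 8 ∷ 4 ∷ 5 ∷ 15 ∷ 21 ∷ 20 ∷ 6 ∷ 7 ∷ 31 ∷ 30 ∷ 26 ∷ 2 ∷ 3 ∷ 32 ∷ 19 ∷ 0 ∷ 1 ∷ 29 ∷ 22 ∷ 27 ∷ 28 ∷ 23 ∷ 24 ∷ 25 ∷ 18 ∷ [])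
    ∷ (9 ∷ 12 ∷ 11 ∷ 10 ∷ 24 ∷ 23 ∷ 28 ∷ 27 ∷ 14 ∷ 15 ∷ 5 ∷ 6 ∷ 20 ∷ 21 ∷ 22 ∷ 29 ∷ 1 ∷ 0 ∷ 19 ∷ 32 ∷ 3 ∷ 2 ∷ 26 ∷ 25 ∷ 18 ∷ 17 ∷ 30 ∷ 31 ∷ 7 ∷ 8 ∷ 4 ∷ 13 ∷ 16 ∷ [])
    ∷ (10 ∷ 9 ∷ 12 ∷ 11 ∷ 28 ∷ 27 ∷ 14 ∷ 13 ∷ 16 ∷ 17 ∷ 8 ∷ 4 ∷ 5 ∷ 15 ∷ 21 ∷ 22 ∷ 0 ∷ 3 ∷ 32 ∷ 19 ∷ 20 ∷ 6 ∷ 7 ∷ 31 ∷ 30 ∷ 26 ∷ 2 ∷ 1 ∷ 29 ∷ 23 ∷ 24 ∷ 25 ∷ 18 ∷ [])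
    ∷ (11 ∷ 10 ∷ 9 ∷ 12 ∷ 14 ∷ 15 ∷ 5 ∷ 6 ∷ 20 ∷ 21 ∷ 22 ∷ 27 ∷ 28 ∷ 23 ∷ 29 ∷ 1 ∷ 0 ∷ 19 ∷ 32 ∷ 3 ∷ 2 ∷ 26 ∷ 30 ∷ 31 ∷ 7 ∷ 8 ∷ 4 ∷ 13 ∷ 16 ∷ 17 ∷ 18 ∷ 25 ∷ 24 ∷ [])
    ∷ (9 ∷ 10 ∷ 11 ∷ 12 ∷ 28 ∷ 23 ∷ 24 ∷ 25 ∷ 18 ∷ 17 ∷ 8 ∷ 4 ∷ 5 ∷ 15 ∷ 21 ∷ 20 ∷ 6 ∷ 7 ∷ 31 ∷ 30 ∷ 26 ∷ 2 ∷ 3 ∷ 32 ∷ 19 ∷ 0 ∷ 1 ∷ 29 ∷ 22 ∷ 27 ∷ 14 ∷ 13 ∷ 16 ∷ [])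
    ∷ (4 ∷ 5 ∷ 6 ∷ 7 ∷ 31 ∷ 30 ∷ 26 ∷ 2 ∷ 1 ∷ 29 ∷ 22 ∷ 0 ∷ 3 ∷ 32 ∷ 19 ∷ 20 ∷ 21 ∷ 15 ∷ 14 ∷ 27 ∷ 28 ∷ 23 ∷ 24 ∷ 25 ∷ 18 ∷ 10 ∷ 11 ∷ 12 ∷ 13 ∷ 9 ∷ 16 ∷ 17 ∷ 8 ∷ [])
    ∷ (13 ∷ 9 ∷ 10 ∷ 11 ∷ 24 ∷ 25 ∷ 18 ∷ 17 ∷ 16 ∷ 14 ∷ 4 ∷ 8 ∷ 7 ∷ 6 ∷ 5 ∷ 15 ∷ 21 ∷ 20 ∷ 19 ∷ 31 ∷ 30 ∷ 26 ∷ 32 ∷ 3 ∷ 0 ∷ 1 ∷ 2 ∷ 23 ∷ 29 ∷ 22 ∷ 27 ∷ 28 ∷ 12 ∷ [])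
    ∷ (5 ∷ 4 ∷ 8 ∷ 7 ∷ 31 ∷ 19 ∷ 0 ∷ 1 ∷ 29 ∷ 23 ∷ 2 ∷ 3 ∷ 32 ∷ 26 ∷ 30 ∷ 17 ∷ 16 ∷ 14 ∷ 15 ∷ 13 ∷ 9 ∷ 10 ∷ 18 ∷ 25 ∷ 24 ∷ 11 ∷ 12 ∷ 28 ∷ 27 ∷ 22 ∷ 21 ∷ 20 ∷ 6 ∷ [])
    ∷ (9 ∷ 10 ∷ 11 ∷ 12 ∷ 28 ∷ 27 ∷ 22 ∷ 0 ∷ 3 ∷ 32 ∷ 19 ∷ 20 ∷ 21 ∷ 16 ∷ 5 ∷ 6 ∷ 7 ∷ 31 ∷ 30 ∷ 26 ∷ 2 ∷ 1 ∷ 29 ∷ 23 ∷ 24 ∷ 25 ∷ 18 ∷ 17 ∷ 8 ∷ 4 ∷ 14 ∷ 15 ∷ 13 ∷ [])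
    ∷ (8 ∷ 4 ∷ 5 ∷ 6 ∷ 20 ∷ 21 ∷ 16 ∷ 15 ∷ 14 ∷ 17 ∷ 9 ∷ 13 ∷ 12 ∷ 11 ∷ 10 ∷ 18 ∷ 25 ∷ 24 ∷ 23 ∷ 28 ∷ 27 ∷ 22 ∷ 29 ∷ 1 ∷ 0 ∷ 19 ∷ 32 ∷ 3 ∷ 2 ∷ 26 ∷ 30 ∷ 31 ∷ 7 ∷ [])
    ∷ (10 ∷ 9 ∷ 13 ∷ 12 ∷ 28 ∷ 23 ∷ 2 ∷ 3 ∷ 32 ∷ 19 ∷ 0 ∷ 1 ∷ 29 ∷ 22 ∷ 27 ∷ 15 ∷ 14 ∷ 17 ∷ 18 ∷ 8 ∷ 4 ∷ 5 ∷ 16 ∷ 21 ∷ 20 ∷ 6 ∷ 7 ∷ 31 ∷ 30 ∷ 26 ∷ 25 ∷ 24 ∷ 11 ∷ [])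
    ∷ (20 ∷ 6 ∷ 5 ∷ 4 ∷ 8 ∷ 7 ∷ 31 ∷ 30 ∷ 18 ∷ 19 ∷ 10 ∷ 11 ∷ 24 ∷ 25 ∷ 26 ∷ 32 ∷ 3 ∷ 0 ∷ 1 ∷ 2 ∷ 23 ∷ 29 ∷ 22 ∷ 27 ∷ 28 ∷ 12 ∷ 13 ∷ 9 ∷ 17 ∷ 14 ∷ 15 ∷ 16 ∷ 21 ∷ [])
    ∷ (6 ∷ 5 ∷ 4 ∷ 14 ∷ 17 ∷ 9 ∷ 10 ∷ 19 ∷ 25 ∷ 24 ∷ 11 ∷ 12 ∷ 13 ∷ 15 ∷ 16 ∷ 21 ∷ 22 ∷ 27 ∷ 28 ∷ 23 ∷ 29 ∷ 1 ∷ 0 ∷ 3 ∷ 2 ∷ 26 ∷ 32 ∷ 20 ∷ 31 ∷ 30 ∷ 18 ∷ 8 ∷ 7 ∷ [])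
    ∷ (16 ∷ 5 ∷ 4 ∷ 8 ∷ 7 ∷ 6 ∷ 21 ∷ 20 ∷ 31 ∷ 30 ∷ 18 ∷ 19 ∷ 10 ∷ 11 ∷ 24 ∷ 25 ∷ 26 ∷ 32 ∷ 3 ∷ 0 ∷ 1 ∷ 2 ∷ 23 ∷ 29 ∷ 22 ∷ 27 ∷ 28 ∷ 12 ∷ 13 ∷ 9 ∷ 17 ∷ 14 ∷ 15 ∷ [])
    ∷ (22 ∷ 16 ∷ 5 ∷ 4 ∷ 14 ∷ 17 ∷ 9 ∷ 10 ∷ 19 ∷ 25 ∷ 24 ∷ 11 ∷ 12 ∷ 13 ∷ 15 ∷ 27 ∷ 28 ∷ 23 ∷ 29 ∷ 1 ∷ 0 ∷ 3 ∷ 2 ∷ 26 ∷ 32 ∷ 20 ∷ 31 ∷ 30 ∷ 18 ∷ 8 ∷ 7 ∷ 6 ∷ 21 ∷ [])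
    ∷ (24 ∷ 11 ∷ 10 ∷ 9 ∷ 13 ∷ 12 ∷ 28 ∷ 27 ∷ 15 ∷ 16 ∷ 5 ∷ 6 ∷ 21 ∷ 22 ∷ 23 ∷ 29 ∷ 1 ∷ 0 ∷ 20 ∷ 32 ∷ 3 ∷ 2 ∷ 26 ∷ 30 ∷ 31 ∷ 7 ∷ 8 ∷ 4 ∷ 14 ∷ 17 ∷ 18 ∷ 19 ∷ 25 ∷ [])
    ∷ (11 ∷ 10 ∷ 9 ∷ 17 ∷ 14 ∷ 4 ∷ 5 ∷ 16 ∷ 22 ∷ 21 ∷ 6 ∷ 7 ∷ 8 ∷ 18 ∷ 19 ∷ 25 ∷ 26 ∷ 30 ∷ 31 ∷ 20 ∷ 32 ∷ 3 ∷ 0 ∷ 23 ∷ 29 ∷ 1 ∷ 2 ∷ 24 ∷ 28 ∷ 27 ∷ 15 ∷ 13 ∷ 12 ∷ [])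
    ∷ (19 ∷ 10 ∷ 9 ∷ 13 ∷ 12 ∷ 11 ∷ 25 ∷ 24 ∷ 28 ∷ 27 ∷ 15 ∷ 16 ∷ 5 ∷ 6 ∷ 21 ∷ 22 ∷ 23 ∷ 29 ∷ 1 ∷ 0 ∷ 20 ∷ 32 ∷ 3 ∷ 2 ∷ 26 ∷ 30 ∷ 31 ∷ 7 ∷ 8 ∷ 4 ∷ 14 ∷ 17 ∷ 18 ∷ [])
    ∷ (26 ∷ 19 ∷ 10 ∷ 9 ∷ 17 ∷ 14 ∷ 4 ∷ 5 ∷ 16 ∷ 22 ∷ 21 ∷ 6 ∷ 7 ∷ 8 ∷ 18 ∷ 30 ∷ 31 ∷ 20 ∷ 32 ∷ 3 ∷ 0 ∷ 23 ∷ 29 ∷ 1 ∷ 2 ∷ 24 ∷ 28 ∷ 27 ∷ 15 ∷ 13 ∷ 12 ∷ 11 ∷ 25 ∷ [])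
    ∷ (28 ∷ 12 ∷ 11 ∷ 10 ∷ 9 ∷ 13 ∷ 15 ∷ 16 ∷ 5 ∷ 6 ∷ 21 ∷ 22 ∷ 23 ∷ 29 ∷ 1 ∷ 0 ∷ 20 ∷ 32 ∷ 3 ∷ 2 ∷ 27 ∷ 30 ∷ 31 ∷ 7 ∷ 8 ∷ 4 ∷ 14 ∷ 17 ∷ 18 ∷ 19 ∷ 26 ∷ 25 ∷ 24 ∷ [])
    ∷ (12 ∷ 11 ∷ 10 ∷ 9 ∷ 17 ∷ 14 ∷ 4 ∷ 5 ∷ 16 ∷ 22 ∷ 21 ∷ 6 ∷ 7 ∷ 8 ∷ 18 ∷ 19 ∷ 26 ∷ 25 ∷ 24 ∷ 2 ∷ 3 ∷ 32 ∷ 27 ∷ 30 ∷ 31 ∷ 20 ∷ 0 ∷ 1 ∷ 29 ∷ 23 ∷ 28 ∷ 15 ∷ 13 ∷ [])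
    ∷ (1 ∷ 0 ∷ 3 ∷ 32 ∷ 20 ∷ 21 ∷ 6 ∷ 5 ∷ 4 ∷ 8 ∷ 7 ∷ 31 ∷ 30 ∷ 18 ∷ 17 ∷ 14 ∷ 15 ∷ 16 ∷ 22 ∷ 23 ∷ 28 ∷ 29 ∷ 24 ∷ 25 ∷ 11 ∷ 12 ∷ 13 ∷ 9 ∷ 10 ∷ 19 ∷ 26 ∷ 27 ∷ 2 ∷ [])
    ∷ (31 ∷ 7 ∷ 6 ∷ 5 ∷ 4 ∷ 8 ∷ 18 ∷ 19 ∷ 10 ∷ 11 ∷ 25 ∷ 26 ∷ 27 ∷ 32 ∷ 3 ∷ 0 ∷ 1 ∷ 2 ∷ 24 ∷ 30 ∷ 23 ∷ 28 ∷ 29 ∷ 12 ∷ 13 ∷ 9 ∷ 17 ∷ 14 ∷ 15 ∷ 16 ∷ 22 ∷ 21 ∷ 20 ∷ [])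
    ∷ (7 ∷ 6 ∷ 5 ∷ 4 ∷ 14 ∷ 17 ∷ 9 ∷ 10 ∷ 19 ∷ 26 ∷ 25 ∷ 11 ∷ 12 ∷ 13 ∷ 15 ∷ 16 ∷ 22 ∷ 21 ∷ 20 ∷ 0 ∷ 1 ∷ 30 ∷ 23 ∷ 28 ∷ 29 ∷ 24 ∷ 2 ∷ 3 ∷ 32 ∷ 27 ∷ 31 ∷ 18 ∷ 8 ∷ [])
    ∷ (3 ∷ 0 ∷ 1 ∷ 30 ∷ 23 ∷ 22 ∷ 16 ∷ 5 ∷ 4 ∷ 8 ∷ 7 ∷ 6 ∷ 21 ∷ 20 ∷ 32 ∷ 31 ∷ 18 ∷ 17 ∷ 14 ∷ 15 ∷ 28 ∷ 29 ∷ 24 ∷ 25 ∷ 11 ∷ 12 ∷ 13 ∷ 9 ∷ 10 ∷ 19 ∷ 26 ∷ 27 ∷ 2 ∷ [])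
    ∷ []

  -- Cycle v lists the vertices of G ─ v in its own numbering; reducing mod 33
  -- only gives the entries type Fin 33.
  deletionOrder : Fin 34 → Fin 33 → Fin 33
  deletionOrder v i = lookup (lookup cyclesOfDeletions v) i mod 33

  G-vertexDeleted-hamiltonian : ∀ v → Hamiltonian (G ─ v)
  G-vertexDeleted-hamiltonian v =
    hamiltonianOrder⇒hamiltonian (deletionOrder v) {G ─ v} (s≤s (s≤s (s≤s z≤n)))
      (toWitness {a? = all? λ w → isHamiltonianOrder? (deletionOrder w) (G ─ w)} _ v)

  coordinates : Vec (ℤ × ℤ) 34
  coordinates =
      (+ 1000 , + 0) ∷ (+ 0 , + 1000) ∷ (- + 1000 , + 0) ∷ (+ 0 , - + 1000)
    ∷ (+ 61 , - + 13) ∷ (+ 118 , - + 10) ∷ (+ 155 , - + 38) ∷ (+ 104 , - + 58)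
    ∷ (+ 37 , - + 37) ∷ (- + 61 , + 13) ∷ (- + 118 , + 10) ∷ (- + 155 , + 38)
    ∷ (- + 104 , + 58) ∷ (- + 37 , + 37) ∷ (+ 29 , + 7) ∷ (+ 54 , + 40)
    ∷ (+ 136 , + 23) ∷ (- + 29 , - + 7) ∷ (- + 54 , - + 40) ∷ (- + 136 , - + 23)
    ∷ (+ 342 , - + 143) ∷ (+ 245 , - + 48) ∷ (+ 237 , + 38) ∷ (+ 330 , + 139)
    ∷ (- + 342 , + 143) ∷ (- + 245 , + 48) ∷ (- + 237 , - + 38) ∷ (- + 330 , - + 139)
    ∷ (+ 89 , + 92) ∷ (- + 119 , + 98) ∷ (- + 4 , + 428) ∷ (- + 89 , - + 92)
    ∷ (+ 119 , - + 98) ∷ (+ 4 , - + 428)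
    ∷ []

  G-planar : Planar G
  G-planar = toPlaneDrawing _ _ _
    where open StraightLineDrawing G (lookup coordinates) (forwardEdges neighbourList)
                                   (forwardEdges-listed G neighbourList adjacent⇒∈neighbourList)

open Witness using (G; G-planar; G-nonHamiltonian; G-vertexDeleted-hamiltonian)

mainTheorem4 : Σ (Graph 34) λ G → Planar G × Hypohamiltonian G × numVerticesOfDegree G 3 ≡ 26
mainTheorem4 = G , G-planar , (G-nonHamiltonian , G-vertexDeleted-hamiltonian) , refl
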